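{- Let $G$ be a random threshold graph on $n\ge1$ vertices and let $k$ be a nonnegative integer. Then $$P(\nu(G)=k)=\begin{cases}\left(\tfrac12\right)^{n-1}\binom{n}{k} & k<\tfrac n2,\\[4pt] \left(\tfrac12\right)^{n-1}\binom{n-1}{\lfloor\frac{n-1}{2}\rfloor} & k=\tfrac n2.\end{cases}$$
   Context: $\nu(G)$ is the number of edges in a maximum matching of $G$. A threshold graph on $n$ vertices is built from a single base vertex by adding $n-1$ vertices one at a time, each either isolated or dominating (adjacent to all existing vertices); its creation sequence records $1$ for a dominating and $0$ for an isolated addition. A random threshold graph on $n$ vertices is obtained by choosing $n$ weights independently and uniformly in $[0,1]$ and joining two vertices iff their weights sum to more than $1$; it is known that this makes the creation sequence uniformly distributed on $\{0,1\}^{n-1}$. -}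

module Defs where

open import Data.Nat using (ℕ; zero; suc; _<_; _≤_)
open import Data.Fin using (Fin; zero; suc; toℕ)
open import Data.Bool using (Bool; true; false)
open import Data.Vec using (Vec; lookup)
open import Data.List using (List; []; _∷_; length; concatMap)
open import Data.List.Relation.Unary.All using (All)
open import Data.List.Relation.Unary.Unique.Propositional using (Unique)
open import Data.List.Membership.Propositional using (_∈_)
open import Data.Product using (_×_; _,_; Σ; ∃)
open import Data.Sum using (_⊎_)
open import Relation.Binary.PropositionalEquality using (_≡_)
open import Function.Bundles using (_⇔_)

Graph : ℕ → Set₁
Graph n = Fin n → Fin n → Set

-- Creation sequence of a threshold graph on suc m vertices: a bit for each of the
-- m vertices added after the base vertex 0 (true = dominating, false = isolated).
-- Vertex j ≥ 1 is the j-th added vertex; the base vertex 0 has no bit.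
dominating : ∀ {m} → Vec Bool m → Fin (suc m) → Bool
dominating s zero    = false
dominating s (suc j) = lookup s j

thresholdGraph : ∀ {m} → Vec Bool m → Graph (suc m)
thresholdGraph s u v =
  (toℕ u < toℕ v × dominating s v ≡ true) ⊎ (toℕ v < toℕ u × dominating s u ≡ true)

endpoints : ∀ {n} → List (Fin n × Fin n) → List (Fin n)
endpoints = concatMap (λ { (u , v) → u ∷ v ∷ [] })

IsMatching : ∀ {n} → Graph n → List (Fin n × Fin n) → Set
IsMatching G M = All (λ { (u , v) → G u v }) M × Unique (endpoints M)

MatchingNumber : ∀ {n} → Graph n → ℕ → Set
MatchingNumber G k =
  (Σ _ λ M → IsMatching G M × length M ≡ k) ×
  (∀ M → IsMatching G M → length M ≤ k)

NumberOfSequences : (m : ℕ) → (Vec Bool m → Set) → ℕ → Set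
NumberOfSequences m P c =
  Σ (List (Vec Bool m)) λ L → Unique L × (∀ s → (s ∈ L) ⇔ P s) × length L ≡ c

{-# OPTIONS --safe #-}
-- The matching number is computed greedily along the creation sequence: an isolated vertex
-- changes nothing, and a dominating vertex joining n older vertices of which 2 k are matched
-- raises it to k + 1 exactly when 2 k < n, since it can be matched to any free older vertex
-- while the edges avoiding it form a matching of the older graph. Splitting the sequences by
-- their last bit gives a Pascal-type recurrence for the number of sequences with matching
-- number k, solved by (n choose k) below the middle; at k = n / 2 the symmetry
-- C(2j+1, j+1) = C(2j+1, j) turns it into the central coefficient of n − 1.
module Submission where

open import Defs
open import Data.Nat using (ℕ; zero; suc; pred; _+_; _*_; _/_; _≤_; _<_; z≤n; s≤s; s≤s⁻¹; z<s)
open import Data.Nat.Properties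
open import Data.Nat.Combinatorics using (_C_; nCk+nC[k+1]≡[n+1]C[k+1]; nCk≡nC[n∸k])
open import Data.Nat.DivMod using (+-distrib-/-∣ʳ; m*n/n≡m)
open import Data.Nat.Divisibility using (divides-refl)
open import Algebra.Properties.CommutativeSemigroup +-commutativeSemigroup using (x∙yz≈y∙xz)
open import Data.Bool using (Bool; true; false)
open import Data.Vec using (Vec; []; _∷_; _∷ʳ_; lookup; init; last; initLast)
open import Data.Vec.Properties using (init-∷ʳ; last-∷ʳ; ∷ʳ-injectiveˡ; ∷ʳ-injectiveʳ)
open import Data.Fin as Fin using (Fin; toℕ; fromℕ<)
open import Data.Fin.Properties using (toℕ-injective; toℕ-fromℕ<)
open import Data.List using (List; []; _∷_; length; map; filter; _++_)
open import Data.List.Properties using (length-map; length-++; filter-all; filter-accept; filter-reject; filter-notAll)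
open import Data.List.Relation.Unary.All as All using (All; []; _∷_)
import Data.List.Relation.Unary.All.Properties as All
open import Data.List.Relation.Unary.Any as Any using (here)
open import Data.List.Relation.Unary.AllPairs using ([]; _∷_)
open import Data.List.Relation.Unary.Unique.Propositional using (Unique)
import Data.List.Relation.Unary.Unique.Propositional.Properties as Unique
open import Data.List.Relation.Binary.Disjoint.Propositional using (Disjoint)
open import Data.List.Membership.Propositional using (_∈_; _∉_)
open import Data.List.Membership.Propositional.Properties using (∈-filter⁺; ∈-map⁺; ∈-map⁻; ∈-++⁺ˡ; ∈-++⁺ʳ; ∈-++⁻)
open import Data.List.Membership.DecPropositional _≟_ using (_∈?_)
open import Data.Product as Product using (_×_; _,_; Σ; ∃; proj₁; proj₂; uncurry)
open import Data.Sum as Sum using (_⊎_; inj₁; inj₂; [_,_])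
open import Function using (_∘_)
open import Function.Bundles using (_⇔_; mk⇔; Equivalence)
open import Function.Construct.Composition using (_⇔-∘_)
open import Relation.Nullary using (¬_; yes; no; contradiction; ¬?)
open import Relation.Nullary.Decidable using (_×-dec_)
open import Relation.Unary using (Decidable)
open import Relation.Binary.PropositionalEquality
  using (_≡_; _≢_; ≢-sym; refl; sym; trans; cong; cong₂; subst; module ≡-Reasoning)

open Equivalence using (to; from)

numberOfSequences-⇔ : ∀ {m} {P Q : Vec Bool m → Set} {c} →
  (∀ s → P s ⇔ Q s) → NumberOfSequences m P c → NumberOfSequences m Q c
numberOfSequences-⇔ P⇔Q (L , unique , mem , len) = L , unique , (λ s → P⇔Q s ⇔-∘ mem s) , len

numberOfSequences-∅ : ∀ {m} {P : Vec Bool m → Set} → (∀ s → ¬ P s) → NumberOfSequences m P 0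
numberOfSequences-∅ ¬P = [] , [] , (λ s → mk⇔ (λ ()) (λ p → contradiction p (¬P s))) , refl

numberOfSequences-[] : {P : Vec Bool 0 → Set} → P [] → NumberOfSequences 0 P 1
numberOfSequences-[] p = [] ∷ [] , [] ∷ [] , (λ { [] → mk⇔ (λ _ → p) (λ _ → here refl) }) , refl

numberOfSequences-×-yes : ∀ {m} {P : Vec Bool m → Set} {Q : Set} {c} →
  Q → NumberOfSequences m P c → NumberOfSequences m (λ s → P s × Q) c
numberOfSequences-×-yes q = numberOfSequences-⇔ (λ _ → mk⇔ (_, q) proj₁)

numberOfSequences-×-no : ∀ {m} {P : Vec Bool m → Set} {Q : Set} →
  ¬ Q → NumberOfSequences m (λ s → P s × Q) 0
numberOfSequences-×-no ¬q = numberOfSequences-∅ (λ _ → ¬q ∘ proj₂)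

numberOfSequences-⊎ : ∀ {m} {P Q : Vec Bool m → Set} {a b} → (∀ s → P s → ¬ Q s) →
  NumberOfSequences m P a → NumberOfSequences m Q b → NumberOfSequences m (λ s → P s ⊎ Q s) (a + b)
numberOfSequences-⊎ P⇒¬Q (LP , uniqueP , memP , lenP) (LQ , uniqueQ , memQ , lenQ) =
  LP ++ LQ ,
  Unique.++⁺ uniqueP uniqueQ (λ {s} (s∈LP , s∈LQ) → P⇒¬Q s (to (memP s) s∈LP) (to (memQ s) s∈LQ)) ,
  (λ s → mk⇔ (Sum.map (to (memP s)) (to (memQ s)) ∘ ∈-++⁻ LP)
             [ ∈-++⁺ˡ ∘ from (memP s) , ∈-++⁺ʳ LP ∘ from (memQ s) ]) ,
  trans (length-++ LP) (cong₂ _+_ lenP lenQ)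

numberOfSequences-∷ʳ : ∀ {m} {P : Vec Bool (suc m) → Set} {a b} →
  NumberOfSequences m (λ t → P (t ∷ʳ false)) a → NumberOfSequences m (λ t → P (t ∷ʳ true)) b →
  NumberOfSequences (suc m) P (a + b)
numberOfSequences-∷ʳ {m} {P} (L₀ , unique₀ , mem₀ , len₀) (L₁ , unique₁ , mem₁ , len₁) =
  L ,
  Unique.++⁺ (Unique.map⁺ (∷ʳ-injectiveˡ _ _) unique₀) (Unique.map⁺ (∷ʳ-injectiveˡ _ _) unique₁) lastsDiffer ,
  (λ s → mk⇔ (sound s) (complete s)) ,
  trans (length-++ (map _ L₀)) (cong₂ _+_ (trans (length-map _ L₀) len₀) (trans (length-map _ L₁) len₁))
  where
  L : List (Vec Bool (suc m))
  L = map (_∷ʳ false) L₀ ++ map (_∷ʳ true) L₁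

  lastsDiffer : Disjoint (map (_∷ʳ false) L₀) (map (_∷ʳ true) L₁)
  lastsDiffer (s∈L₀ , s∈L₁) with ∈-map⁻ (_∷ʳ false) s∈L₀ | ∈-map⁻ (_∷ʳ true) s∈L₁
  ... | t₀ , _ , refl | t₁ , _ , eq with ∷ʳ-injectiveʳ t₀ t₁ eq
  ... | ()

  sound : ∀ s → s ∈ L → P s
  sound s s∈L with ∈-++⁻ (map (_∷ʳ false) L₀) s∈L
  ... | inj₁ s∈L₀ with ∈-map⁻ (_∷ʳ false) s∈L₀
  ...   | t , t∈L₀ , refl = to (mem₀ t) t∈L₀
  sound s s∈L | inj₂ s∈L₁ with ∈-map⁻ (_∷ʳ true) s∈L₁
  ...   | t , t∈L₁ , refl = to (mem₁ t) t∈L₁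

  complete : ∀ s → P s → s ∈ L
  complete s Ps with initLast s
  ... | t , false , refl = ∈-++⁺ˡ (∈-map⁺ (_∷ʳ false) (from (mem₀ t) Ps))
  ... | t , true  , refl = ∈-++⁺ʳ (map (_∷ʳ false) L₀) (∈-map⁺ (_∷ʳ true) (from (mem₁ t) Ps))

length≤suc-length-filter-≢ : ∀ x {xs : List ℕ} → Unique xs →
  length xs ≤ suc (length (filter (λ y → ¬? (y ≟ x)) xs))
length≤suc-length-filter-≢ x {[]} [] = z≤n
length≤suc-length-filter-≢ x {y ∷ xs} (y∉xs ∷ unique) with y ≟ x
... | no y≢x rewrite filter-accept (λ z → ¬? (z ≟ x)) {y} {xs} y≢x =
  s≤s (length≤suc-length-filter-≢ x unique)
... | yes refl rewrite filter-reject (λ z → ¬? (z ≟ x)) {y} {xs} (λ y≢y → y≢y refl) =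
  s≤s (≤-reflexive (cong length (sym (filter-all (λ z → ¬? (z ≟ y)) (All.map ≢-sym y∉xs)))))

length-unique≤ : ∀ n {xs : List ℕ} → Unique xs → All (_< n) xs → length xs ≤ n
length-unique≤ zero    {[]}    _ _ = z≤n
length-unique≤ zero    {_ ∷ _} _ (() ∷ _)
length-unique≤ (suc n) {xs} unique xs<1+n =
  ≤-trans (length≤suc-length-filter-≢ n unique)
          (s≤s (length-unique≤ n (Unique.filter⁺ ≢n? unique) rest<n))
  where
  ≢n? : Decidable (_≢ n)
  ≢n? y = ¬? (y ≟ n)
  rest<n : All (_< n) (filter ≢n? xs)
  rest<n = All.zipWith (λ (y<1+n , y≢n) → ≤∧≢⇒< (s≤s⁻¹ y<1+n) y≢n)
                       (All.filter⁺ ≢n? xs<1+n , All.all-filter ≢n? xs)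

∃-∉-below : ∀ n (xs : List ℕ) → length xs < n → ∃ λ w → w < n × w ∉ xs
∃-∉-below (suc n) xs |xs|<1+n with n ∈? xs
... | no n∉xs = n , ≤-refl , n∉xs
... | yes n∈xs
  with w , w<n , w∉ ← ∃-∉-below n (filter (_<? n) xs)
         (≤-trans (filter-notAll (_<? n) xs (Any.map (λ { refl → n≮n n }) n∈xs)) (s≤s⁻¹ |xs|<1+n))
  = w , m<n⇒m<1+n w<n , λ w∈xs → w∉ (∈-filter⁺ (_<? n) w∈xs w<n)

endpointsℕ : List (ℕ × ℕ) → List ℕ
endpointsℕ []            = []
endpointsℕ ((u , v) ∷ M) = u ∷ v ∷ endpointsℕ M

-- Vertices are naturals, so that adding a vertex to a graph needs no re-indexing.
IsMatchingℕ : (ℕ → ℕ → Set) → List (ℕ × ℕ) → Set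
IsMatchingℕ R M = All (uncurry R) M × Unique (endpointsℕ M)

MatchingNumberℕ : (ℕ → ℕ → Set) → ℕ → Set
MatchingNumberℕ R k =
  (Σ _ λ M → IsMatchingℕ R M × length M ≡ k) ×
  (∀ M → IsMatchingℕ R M → length M ≤ k)

length-endpointsℕ : ∀ M → length (endpointsℕ M) ≡ 2 * length M
length-endpointsℕ []            = refl
length-endpointsℕ ((u , v) ∷ M) =
  trans (cong (suc ∘ suc) (length-endpointsℕ M)) (sym (*-suc 2 (length M)))

All-endpointsℕ : ∀ {R : ℕ → ℕ → Set} {P : ℕ → Set} → (∀ {u v} → R u v → P u × P v) →
  ∀ {M} → All (uncurry R) M → All P (endpointsℕ M)
All-endpointsℕ both []       = []
All-endpointsℕ both (r ∷ rs) = proj₁ (both r) ∷ proj₂ (both r) ∷ All-endpointsℕ both rs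

2*length≤ : ∀ {R : ℕ → ℕ → Set} {n} → (∀ {u v} → R u v → u < n × v < n) →
  ∀ {M} → IsMatchingℕ R M → 2 * length M ≤ n
2*length≤ {n = n} bounded {M} (edges , unique) =
  subst (_≤ n) (length-endpointsℕ M) (length-unique≤ n unique (All-endpointsℕ bounded edges))

matchingℕ-map : ∀ {R R′ : ℕ → ℕ → Set} → (∀ {u v} → R u v → R′ u v) →
  ∀ {M} → IsMatchingℕ R M → IsMatchingℕ R′ M
matchingℕ-map R⇒R′ (edges , unique) = All.map R⇒R′ edges , unique

matchingℕ-∷ : ∀ {R : ℕ → ℕ → Set} {M w x} → IsMatchingℕ R M → R w x → w ≢ x →
  w ∉ endpointsℕ M → x ∉ endpointsℕ M → IsMatchingℕ R ((w , x) ∷ M)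
matchingℕ-∷ {M = M} (edges , unique) r w≢x w∉M x∉M =
  r ∷ edges , (w≢x ∷ All.¬Any⇒All¬ _ w∉M) ∷ All.¬Any⇒All¬ _ x∉M ∷ unique

Avoids : ℕ → ℕ × ℕ → Set
Avoids x (u , v) = u ≢ x × v ≢ x

avoids? : ∀ x → Decidable (Avoids x)
avoids? x (u , v) = ¬? (u ≟ x) ×-dec ¬? (v ≟ x)

All-endpointsℕ-filter : ∀ {P : ℕ × ℕ → Set} (P? : Decidable P) {Q : ℕ → Set} M →
  All Q (endpointsℕ M) → All Q (endpointsℕ (filter P? M))
All-endpointsℕ-filter P? []            _               = []
All-endpointsℕ-filter P? ((u , v) ∷ M) (qu ∷ qv ∷ qM) with P? (u , v)
... | yes _ = qu ∷ qv ∷ All-endpointsℕ-filter P? M qM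
... | no  _ = All-endpointsℕ-filter P? M qM

unique-endpointsℕ-filter : ∀ {P : ℕ × ℕ → Set} (P? : Decidable P) M →
  Unique (endpointsℕ M) → Unique (endpointsℕ (filter P? M))
unique-endpointsℕ-filter P? []            _ = []
unique-endpointsℕ-filter P? ((u , v) ∷ M) ((u≢v ∷ u∉M) ∷ v∉M ∷ unique) with P? (u , v)
... | yes _ = (u≢v ∷ All-endpointsℕ-filter P? M u∉M) ∷ All-endpointsℕ-filter P? M v∉M
            ∷ unique-endpointsℕ-filter P? M unique
... | no  _ = unique-endpointsℕ-filter P? M unique

matchingℕ-avoiding : ∀ {R : ℕ → ℕ → Set} x {M} → IsMatchingℕ R M →
  IsMatchingℕ (λ u v → R u v × Avoids x (u , v)) (filter (avoids? x) M)
matchingℕ-avoiding x {M} (edges , unique) =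
  All.zipWith (λ rx → rx) (All.filter⁺ (avoids? x) edges , All.all-filter (avoids? x) M) ,
  unique-endpointsℕ-filter (avoids? x) M unique

All-avoids : ∀ x M → All (x ≢_) (endpointsℕ M) → All (Avoids x) M
All-avoids x []            _                 = []
All-avoids x ((u , v) ∷ M) (x≢u ∷ x≢v ∷ x∉M) = (≢-sym x≢u , ≢-sym x≢v) ∷ All-avoids x M x∉M

length≤suc-length-filter-avoids : ∀ x M → Unique (endpointsℕ M) →
  length M ≤ suc (length (filter (avoids? x) M))
length≤suc-length-filter-avoids x [] _ = z≤n
length≤suc-length-filter-avoids x ((u , v) ∷ M) ((_ ∷ u∉M) ∷ v∉M ∷ unique) with avoids? x (u , v)
... | yes avoids rewrite filter-accept (avoids? x) {u , v} {M} avoids =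
  s≤s (length≤suc-length-filter-avoids x M unique)
... | no meets rewrite filter-reject (avoids? x) {u , v} {M} meets =
  s≤s (≤-reflexive (cong length (sym (filter-all (avoids? x) (All-avoids x M x∉M)))))
  where
  x∉M : All (x ≢_) (endpointsℕ M)
  x∉M with u ≟ x | v ≟ x
  ... | yes refl | _        = u∉M
  ... | no _     | yes refl = v∉M
  ... | no u≢x   | no v≢x   = contradiction (u≢x , v≢x) meets

-- Bits beyond the end of c read as false.
bit : ∀ {n} → Vec Bool n → ℕ → Bool
bit []      _       = false
bit (b ∷ c) zero    = b
bit (b ∷ c) (suc i) = bit c i

bit-true⇒< : ∀ {n} (c : Vec Bool n) {i} → bit c i ≡ true → i < n
bit-true⇒< (b ∷ c) {zero}  _  = z<s
bit-true⇒< (b ∷ c) {suc i} eq = s≤s (bit-true⇒< c eq)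

bit-∷ʳ-< : ∀ {n} (c : Vec Bool n) b {i} → i < n → bit (c ∷ʳ b) i ≡ bit c i
bit-∷ʳ-< (x ∷ c) b {zero}  _         = refl
bit-∷ʳ-< (x ∷ c) b {suc i} (s≤s i<n) = bit-∷ʳ-< c b i<n

bit-∷ʳ-last : ∀ {n} (c : Vec Bool n) b → bit (c ∷ʳ b) n ≡ b
bit-∷ʳ-last []      b = refl
bit-∷ʳ-last (x ∷ c) b = bit-∷ʳ-last c b

bit-∷ʳ-false : ∀ {n} (c : Vec Bool n) i → bit (c ∷ʳ false) i ≡ bit c i
bit-∷ʳ-false []      zero    = refl
bit-∷ʳ-false []      (suc i) = refl
bit-∷ʳ-false (x ∷ c) zero    = refl
bit-∷ʳ-false (x ∷ c) (suc i) = bit-∷ʳ-false c i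

bit-∷ʳ-true⇒ : ∀ {n} (c : Vec Bool n) b {i} → bit (c ∷ʳ b) i ≡ true → i ≢ n → bit c i ≡ true
bit-∷ʳ-true⇒ c b {i} eq i≢n =
  trans (sym (bit-∷ʳ-< c b (≤∧≢⇒< (s≤s⁻¹ (bit-true⇒< (c ∷ʳ b) eq)) i≢n))) eq

lookup≡bit : ∀ {n} (c : Vec Bool n) i → lookup c i ≡ bit c (toℕ i)
lookup≡bit (b ∷ c) Fin.zero    = refl
lookup≡bit (b ∷ c) (Fin.suc i) = lookup≡bit c i

dominating≡bit : ∀ {m} (s : Vec Bool m) v → dominating s v ≡ bit (false ∷ s) (toℕ v)
dominating≡bit s Fin.zero    = refl
dominating≡bit s (Fin.suc j) = lookup≡bit s j

ThresholdEdge : ∀ {n} → Vec Bool n → ℕ → ℕ → Set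
ThresholdEdge c u v = (u < v × bit c v ≡ true) ⊎ (v < u × bit c u ≡ true)

thresholdGraph⇔ThresholdEdge : ∀ {m} (s : Vec Bool m) u v →
  thresholdGraph s u v ⇔ ThresholdEdge (false ∷ s) (toℕ u) (toℕ v)
thresholdGraph⇔ThresholdEdge s u v = mk⇔
  (Sum.map (Product.map₂ (trans (sym (dominating≡bit s v)))) (Product.map₂ (trans (sym (dominating≡bit s u)))))
  (Sum.map (Product.map₂ (trans (dominating≡bit s v))) (Product.map₂ (trans (dominating≡bit s u))))

thresholdEdge-bounded : ∀ {n} (c : Vec Bool n) {u v} → ThresholdEdge c u v → u < n × v < n
thresholdEdge-bounded c (inj₁ (u<v , dv)) = <-trans u<v (bit-true⇒< c dv) , bit-true⇒< c dv
thresholdEdge-bounded c (inj₂ (v<u , du)) = bit-true⇒< c du , <-trans v<u (bit-true⇒< c du)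

thresholdEdge-∷ʳ : ∀ {n} (c : Vec Bool n) b {u v} → ThresholdEdge c u v → ThresholdEdge (c ∷ʳ b) u v
thresholdEdge-∷ʳ c b (inj₁ (u<v , dv)) = inj₁ (u<v , trans (bit-∷ʳ-< c b (bit-true⇒< c dv)) dv)
thresholdEdge-∷ʳ c b (inj₂ (v<u , du)) = inj₂ (v<u , trans (bit-∷ʳ-< c b (bit-true⇒< c du)) du)

thresholdEdge-∷ʳ⁻ : ∀ {n} (c : Vec Bool n) b {u v} →
  ThresholdEdge (c ∷ʳ b) u v → Avoids n (u , v) → ThresholdEdge c u v
thresholdEdge-∷ʳ⁻ c b (inj₁ (u<v , dv)) (_ , v≢n) = inj₁ (u<v , bit-∷ʳ-true⇒ c b dv v≢n)
thresholdEdge-∷ʳ⁻ c b (inj₂ (v<u , du)) (u≢n , _) = inj₂ (v<u , bit-∷ʳ-true⇒ c b du u≢n)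

thresholdEdge-∷ʳ-false : ∀ {n} (c : Vec Bool n) {u v} → ThresholdEdge (c ∷ʳ false) u v → ThresholdEdge c u v
thresholdEdge-∷ʳ-false c {v = v} (inj₁ (u<v , dv)) = inj₁ (u<v , trans (sym (bit-∷ʳ-false c v)) dv)
thresholdEdge-∷ʳ-false c {u = u} (inj₂ (v<u , du)) = inj₂ (v<u , trans (sym (bit-∷ʳ-false c u)) du)

thresholdEdge-∷ʳ-true : ∀ {n} (c : Vec Bool n) {w} → w < n → ThresholdEdge (c ∷ʳ true) w n
thresholdEdge-∷ʳ-true c w<n = inj₁ (w<n , bit-∷ʳ-last c true)

-- A new vertex joins n older ones, 2 k of which are matched.
greedyStep : ℕ → ℕ → Bool → ℕ
greedyStep n k false = k
greedyStep n k true with 2 * k <? n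
... | yes _ = suc k
... | no  _ = k

greedyStep-true-< : ∀ {n k} → 2 * k < n → greedyStep n k true ≡ suc k
greedyStep-true-< {n} {k} 2k<n with 2 * k <? n
... | yes _    = refl
... | no 2k≮n = contradiction 2k<n 2k≮n

greedyStep-true-≮ : ∀ {n k} → ¬ 2 * k < n → greedyStep n k true ≡ k
greedyStep-true-≮ {n} {k} 2k≮n with 2 * k <? n
... | yes 2k<n = contradiction 2k<n 2k≮n
... | no  _    = refl

ν : ∀ {n} → Vec Bool n → ℕ
ν {zero}  []  = 0
ν {suc n} c  = greedyStep n (ν (init c)) (last c)

ν-∷ʳ : ∀ {n} (c : Vec Bool n) b → ν (c ∷ʳ b) ≡ greedyStep n (ν c) b
ν-∷ʳ c b rewrite init-∷ʳ b c | last-∷ʳ b c = refl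

2*m≤1+2*n⇒m≤n : ∀ {m n} → 2 * m ≤ suc (2 * n) → m ≤ n
2*m≤1+2*n⇒m≤n {m} {n} 2m≤1+2n =
  s≤s⁻¹ (*-cancelˡ-< 2 m (suc n) (subst (suc (2 * m) ≤_) (sym (*-suc 2 n)) (s≤s 2m≤1+2n)))

greedyMatching-∷ʳ : ∀ {n} (c : Vec Bool n) b {M} → IsMatchingℕ (ThresholdEdge c) M →
  ∃ λ M′ → IsMatchingℕ (ThresholdEdge (c ∷ʳ b)) M′ × length M′ ≡ greedyStep n (length M) b
greedyMatching-∷ʳ c false {M} isM = M , matchingℕ-map (thresholdEdge-∷ʳ c false) isM , refl
greedyMatching-∷ʳ {n} c true {M} isM with 2 * length M <? n
... | no _ = M , matchingℕ-map (thresholdEdge-∷ʳ c true) isM , refl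
... | yes 2k<n
  with w , w<n , w∉M ← ∃-∉-below n (endpointsℕ M) (subst (_< n) (sym (length-endpointsℕ M)) 2k<n)
  = (w , n) ∷ M ,
    matchingℕ-∷ (matchingℕ-map (thresholdEdge-∷ʳ c true) isM) (thresholdEdge-∷ʳ-true c w<n)
                (<⇒≢ w<n) w∉M n∉M ,
    refl
  where
  n∉M : n ∉ endpointsℕ M
  n∉M = All.All¬⇒¬Any (All.map (λ y<n n≡y → <-irrefl (sym n≡y) y<n)
                                 (All-endpointsℕ (thresholdEdge-bounded c) (proj₁ isM)))

greedyMatching-maximal-∷ʳ : ∀ {n} (c : Vec Bool n) b {k} →
  (∀ M → IsMatchingℕ (ThresholdEdge c) M → length M ≤ k) →
  ∀ M → IsMatchingℕ (ThresholdEdge (c ∷ʳ b)) M → length M ≤ greedyStep n k b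
greedyMatching-maximal-∷ʳ c false maximal M isM = maximal M (matchingℕ-map (thresholdEdge-∷ʳ-false c) isM)
greedyMatching-maximal-∷ʳ {n} c true {k} maximal M isM with 2 * k <? n
... | yes _ = begin
  length M                                ≤⟨ length≤suc-length-filter-avoids n M (proj₂ isM) ⟩
  suc (length (filter (avoids? n) M))     ≤⟨ s≤s (maximal _ oldMatching) ⟩
  suc k                                   ∎
  where
  open ≤-Reasoning
  oldMatching : IsMatchingℕ (ThresholdEdge c) (filter (avoids? n) M)
  oldMatching = matchingℕ-map (uncurry (thresholdEdge-∷ʳ⁻ c true)) (matchingℕ-avoiding n isM)
... | no 2k≮n =
  2*m≤1+2*n⇒m≤n (≤-trans (2*length≤ (thresholdEdge-bounded (c ∷ʳ true)) isM) (s≤s (≮⇒≥ 2k≮n)))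

matchingNumberℕ-∷ʳ : ∀ {n} (c : Vec Bool n) b {k} → MatchingNumberℕ (ThresholdEdge c) k →
  MatchingNumberℕ (ThresholdEdge (c ∷ʳ b)) (greedyStep n k b)
matchingNumberℕ-∷ʳ c b ((M , isM , refl) , maximal) =
  greedyMatching-∷ʳ c b isM , greedyMatching-maximal-∷ʳ c b maximal

ν-matchingNumber : ∀ {n} (c : Vec Bool n) → MatchingNumberℕ (ThresholdEdge c) (ν c)
ν-matchingNumber [] =
  ([] , ([] , []) , refl) ,
  λ { [] _ → z≤n ; (_ ∷ _) (e ∷ _ , _) → contradiction (proj₁ (thresholdEdge-bounded [] e)) λ () }
-- Abstracting initLast c also rewrites init c and last c in the goal to t and b.
ν-matchingNumber {suc n} c with initLast c
... | t , b , refl = matchingNumberℕ-∷ʳ t b (ν-matchingNumber t)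

toℕ² : ∀ {n} → Fin n × Fin n → ℕ × ℕ
toℕ² = Product.map toℕ toℕ

endpointsℕ-map-toℕ² : ∀ {n} (M : List (Fin n × Fin n)) → endpointsℕ (map toℕ² M) ≡ map toℕ (endpoints M)
endpointsℕ-map-toℕ² []            = refl
endpointsℕ-map-toℕ² ((u , v) ∷ M) = cong (λ xs → toℕ u ∷ toℕ v ∷ xs) (endpointsℕ-map-toℕ² M)

isMatching⇔isMatchingℕ : ∀ {n} {G : Graph n} {R : ℕ → ℕ → Set} → (∀ u v → G u v ⇔ R (toℕ u) (toℕ v)) →
  ∀ M → IsMatching G M ⇔ IsMatchingℕ R (map toℕ² M)
isMatching⇔isMatchingℕ G⇔R M = mk⇔
  (λ (edges , unique) →
     All.map⁺ (All.map (to (G⇔R _ _)) edges) ,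
     subst Unique (sym (endpointsℕ-map-toℕ² M)) (Unique.map⁺ toℕ-injective unique))
  (λ (edges , unique) →
     All.map (from (G⇔R _ _)) (All.map⁻ edges) ,
     Unique.map⁻ (subst Unique (endpointsℕ-map-toℕ² M) unique))

map-toℕ²-surjective : ∀ {n} M → All (λ (u , v) → u < n × v < n) M →
  ∃ λ (M′ : List (Fin n × Fin n)) → map toℕ² M′ ≡ M
map-toℕ²-surjective []            []                     = [] , refl
map-toℕ²-surjective ((u , v) ∷ M) ((u<n , v<n) ∷ bounded) with M′ , refl ← map-toℕ²-surjective M bounded =
  (fromℕ< u<n , fromℕ< v<n) ∷ M′ ,
  cong (_∷ map toℕ² M′) (cong₂ _,_ (toℕ-fromℕ< u<n) (toℕ-fromℕ< v<n))

matchingNumber-fromℕ : ∀ {n} {G : Graph n} {R : ℕ → ℕ → Set} {k} →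
  (∀ u v → G u v ⇔ R (toℕ u) (toℕ v)) → (∀ {u v} → R u v → u < n × v < n) →
  MatchingNumberℕ R k → MatchingNumber G k
matchingNumber-fromℕ G⇔R bounded ((M , isM , |M|≡k) , maximal)
  with M′ , refl ← map-toℕ²-surjective M (All.map bounded (proj₁ isM)) =
  (M′ , from (isMatching⇔isMatchingℕ G⇔R M′) isM , trans (sym (length-map toℕ² M′)) |M|≡k) ,
  λ N isN → subst (_≤ _) (length-map toℕ² N) (maximal _ (to (isMatching⇔isMatchingℕ G⇔R N) isN))

matchingNumber-unique : ∀ {n} {G : Graph n} {k k′} → MatchingNumber G k → MatchingNumber G k′ → k ≡ k′
matchingNumber-unique ((M , isM , |M|≡k) , maximal) ((M′ , isM′ , |M′|≡k′) , maximal′) =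
  ≤-antisym (subst (_≤ _) |M|≡k (maximal′ M isM)) (subst (_≤ _) |M′|≡k′ (maximal M′ isM′))

ν₀ : ∀ {m} → Vec Bool m → ℕ
ν₀ s = ν (false ∷ s)

ν₀≡⇔matchingNumber : ∀ {m} (s : Vec Bool m) {k} → ν₀ s ≡ k ⇔ MatchingNumber (thresholdGraph s) k
ν₀≡⇔matchingNumber s = mk⇔ (λ { refl → ν₀-matchingNumber }) (matchingNumber-unique ν₀-matchingNumber)
  where
  ν₀-matchingNumber : MatchingNumber (thresholdGraph s) (ν₀ s)
  ν₀-matchingNumber = matchingNumber-fromℕ (thresholdGraph⇔ThresholdEdge s) (thresholdEdge-bounded (false ∷ s))
                                           (ν-matchingNumber (false ∷ s))

greedyStep-true≡suc⇔ : ∀ n k j →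
  greedyStep n k true ≡ suc j ⇔ ((k ≡ j × 2 * j < n) ⊎ (k ≡ suc j × n ≤ 2 * suc j))
greedyStep-true≡suc⇔ n k j = mk⇔ to′ from′
  where
  to′ : greedyStep n k true ≡ suc j → (k ≡ j × 2 * j < n) ⊎ (k ≡ suc j × n ≤ 2 * suc j)
  to′ eq with 2 * k <? n
  ... | yes 2k<n with refl ← suc-injective eq = inj₁ (refl , 2k<n)
  ... | no 2k≮n with refl ← eq = inj₂ (refl , ≮⇒≥ 2k≮n)
  from′ : (k ≡ j × 2 * j < n) ⊎ (k ≡ suc j × n ≤ 2 * suc j) → greedyStep n k true ≡ suc j
  from′ (inj₁ (refl , 2j<n))   = greedyStep-true-< 2j<n
  from′ (inj₂ (refl , n≤2+2j)) = greedyStep-true-≮ (≤⇒≯ n≤2+2j)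

greedyStep-true≢0 : ∀ n k → greedyStep (suc n) k true ≢ 0
greedyStep-true≢0 n k eq with 2 * k <? suc n
... | yes _   = contradiction eq λ ()
... | no 2k≮n with refl ← eq = 2k≮n z<s

ν₀-∷ʳ : ∀ {m} (t : Vec Bool m) b → ν₀ (t ∷ʳ b) ≡ greedyStep (suc m) (ν₀ t) b
ν₀-∷ʳ t b = ν-∷ʳ (false ∷ t) b

2*ν₀≤ : ∀ {m} (s : Vec Bool m) → 2 * ν₀ s ≤ suc m
2*ν₀≤ s with (M , isM , |M|≡ν₀) , _ ← ν-matchingNumber (false ∷ s) =
  subst (λ k → 2 * k ≤ _) |M|≡ν₀ (2*length≤ (thresholdEdge-bounded (false ∷ s)) isM)

ν₀≡⇔ν₀-∷ʳ-false≡ : ∀ {m} (t : Vec Bool m) {k} → ν₀ t ≡ k ⇔ ν₀ (t ∷ʳ false) ≡ k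
ν₀≡⇔ν₀-∷ʳ-false≡ t = mk⇔ (trans (ν₀-∷ʳ t false)) (trans (sym (ν₀-∷ʳ t false)))

numberOfSequences-ν₀≡0-∷ʳ : ∀ {m a} →
  NumberOfSequences m (λ t → ν₀ t ≡ 0) a → NumberOfSequences (suc m) (λ s → ν₀ s ≡ 0) a
numberOfSequences-ν₀≡0-∷ʳ {m} {a} level₀ = subst (NumberOfSequences (suc m) _) (+-identityʳ a)
  (numberOfSequences-∷ʳ (numberOfSequences-⇔ (λ t → ν₀≡⇔ν₀-∷ʳ-false≡ t) level₀)
                        (numberOfSequences-∅ (λ t → greedyStep-true≢0 m (ν₀ t) ∘ trans (sym (ν₀-∷ʳ t true)))))

-- A sequence reaches ν₀ = j + 1 either with a last bit 0 from level j + 1, or with a last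
-- bit 1 from level j (if a vertex is still free) or from level j + 1 (if none is).
numberOfSequences-ν₀≡suc-∷ʳ : ∀ {m j a b} →
  NumberOfSequences m (λ t → ν₀ t ≡ suc j) a →
  NumberOfSequences m (λ t → (ν₀ t ≡ j × 2 * j < suc m) ⊎ (ν₀ t ≡ suc j × suc m ≤ 2 * suc j)) b →
  NumberOfSequences (suc m) (λ s → ν₀ s ≡ suc j) (a + b)
numberOfSequences-ν₀≡suc-∷ʳ {m} {j} levelˢʲ viaTrue = numberOfSequences-∷ʳ
  (numberOfSequences-⇔ (λ t → ν₀≡⇔ν₀-∷ʳ-false≡ t) levelˢʲ)
  (numberOfSequences-⇔ (λ t → mk⇔ (trans (ν₀-∷ʳ t true) ∘ from (greedyStep-true≡suc⇔ (suc m) (ν₀ t) j))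
                                  (to (greedyStep-true≡suc⇔ (suc m) (ν₀ t) j) ∘ trans (sym (ν₀-∷ʳ t true))))
                       viaTrue)

2*[1+j]≡1+m⇒m≡1+2*j : ∀ {j m} → 2 * suc j ≡ suc m → m ≡ suc (2 * j)
2*[1+j]≡1+m⇒m≡1+2*j {j} 2+2j≡1+m = suc-injective (trans (sym 2+2j≡1+m) (*-suc 2 j))

pascal-central : ∀ {j m} → 2 * suc j ≡ suc m → m C j + (suc m C j + m C j) ≡ suc (suc m) C suc j
pascal-central {j} {m} 2+2j≡1+m with refl ← 2*[1+j]≡1+m⇒m≡1+2*j 2+2j≡1+m = begin
  m C j + (suc m C j + m C j)       ≡⟨ x∙yz≈y∙xz (m C j) (suc m C j) (m C j) ⟩
  suc m C j + (m C j + m C j)       ≡⟨ cong (λ x → suc m C j + (m C j + x)) symmetric ⟨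
  suc m C j + (m C j + m C suc j)   ≡⟨ cong (suc m C j +_) (nCk+nC[k+1]≡[n+1]C[k+1] m j) ⟩
  suc m C j + suc m C suc j         ≡⟨ nCk+nC[k+1]≡[n+1]C[k+1] (suc m) j ⟩
  suc (suc m) C suc j               ∎
  where
  open ≡-Reasoning
  symmetric : m C suc j ≡ m C j
  symmetric = trans (nCk≡nC[n∸k] (s≤s (m≤m+n j (j + 0))))
                    (cong (m C_) (trans (m+n∸m≡n j (j + 0)) (+-identityʳ j)))

Levels : ℕ → ℕ → Set
Levels m k = (2 * k < suc m → NumberOfSequences m (λ s → ν₀ s ≡ k) (suc m C k)) ×
             (2 * k ≡ suc m → NumberOfSequences m (λ s → ν₀ s ≡ k) (m C pred k))

levels : ∀ m k → Levels m k
levels zero    zero    = (λ _ → numberOfSequences-[] refl) , λ ()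
levels zero    (suc j) = (λ { (s≤s ()) }) , λ 2+2j≡1 → contradiction (trans (sym (*-suc 2 j)) 2+2j≡1) λ ()
levels (suc m) zero    = (λ _ → numberOfSequences-ν₀≡0-∷ʳ (proj₁ (levels m zero) z<s)) , λ ()
levels (suc m) (suc j) = below , central
  where
  disjoint : ∀ t → ν₀ t ≡ j × 2 * j < suc m → ¬ (ν₀ t ≡ suc j × suc m ≤ 2 * suc j)
  disjoint t (ν₀≡j , _) (ν₀≡1+j , _) = <⇒≢ (n<1+n j) (trans (sym ν₀≡j) ν₀≡1+j)

  unreachable : suc m < 2 * suc j → ∀ (t : Vec Bool m) → ν₀ t ≢ suc j
  unreachable 1+m<2+2j t ν₀≡1+j = <⇒≱ 1+m<2+2j (subst (λ k → 2 * k ≤ suc m) ν₀≡1+j (2*ν₀≤ t))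

  2j<2+2j : 2 * j < 2 * suc j
  2j<2+2j = *-monoʳ-< 2 (n<1+n j)

  below : 2 * suc j < suc (suc m) →
    NumberOfSequences (suc m) (λ s → ν₀ s ≡ suc j) (suc (suc m) C suc j)
  below 2+2j<2+m with m≤n⇒m<n∨m≡n (s≤s⁻¹ 2+2j<2+m)
  ... | inj₁ 2+2j<1+m =
    subst (NumberOfSequences (suc m) _)
      (trans (cong (suc m C suc j +_) (+-identityʳ (suc m C j)))
             (trans (+-comm (suc m C suc j) (suc m C j)) (nCk+nC[k+1]≡[n+1]C[k+1] (suc m) j)))
      (numberOfSequences-ν₀≡suc-∷ʳ (proj₁ (levels m (suc j)) 2+2j<1+m)
        (numberOfSequences-⊎ disjoint
          (numberOfSequences-×-yes 2j<1+m (proj₁ (levels m j) 2j<1+m))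
          (numberOfSequences-×-no (<⇒≱ 2+2j<1+m))))
    where
    2j<1+m : 2 * j < suc m
    2j<1+m = <-trans 2j<2+2j 2+2j<1+m
  ... | inj₂ 2+2j≡1+m =
    subst (NumberOfSequences (suc m) _) (pascal-central 2+2j≡1+m)
      (numberOfSequences-ν₀≡suc-∷ʳ (proj₂ (levels m (suc j)) 2+2j≡1+m)
        (numberOfSequences-⊎ disjoint
          (numberOfSequences-×-yes 2j<1+m (proj₁ (levels m j) 2j<1+m))
          (numberOfSequences-×-yes (≤-reflexive (sym 2+2j≡1+m)) (proj₂ (levels m (suc j)) 2+2j≡1+m))))
    where
    2j<1+m : 2 * j < suc m
    2j<1+m = subst (2 * j <_) 2+2j≡1+m 2j<2+2j

  central : 2 * suc j ≡ suc (suc m) → NumberOfSequences (suc m) (λ s → ν₀ s ≡ suc j) (suc m C j)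
  central 2+2j≡2+m =
    subst (NumberOfSequences (suc m) _) (+-identityʳ _)
      (numberOfSequences-ν₀≡suc-∷ʳ (numberOfSequences-∅ (unreachable 1+m<2+2j))
        (numberOfSequences-⊎ disjoint
          (numberOfSequences-×-yes 2j<1+m (proj₁ (levels m j) 2j<1+m))
          (numberOfSequences-∅ (λ t → unreachable 1+m<2+2j t ∘ proj₁))))
    where
    1+m<2+2j : suc m < 2 * suc j
    1+m<2+2j = subst (suc m <_) (sym 2+2j≡2+m) (n<1+n (suc m))
    2j<1+m : 2 * j < suc m
    2j<1+m = subst (_< suc m) (suc-injective (2*[1+j]≡1+m⇒m≡1+2*j 2+2j≡2+m)) (n<1+n m)

m/2≡pred[k] : ∀ {m} k → 2 * k ≡ suc m → m / 2 ≡ pred k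
m/2≡pred[k] {m} (suc j) 2+2j≡1+m = begin
  m / 2             ≡⟨ cong (_/ 2) (2*[1+j]≡1+m⇒m≡1+2*j 2+2j≡1+m) ⟩
  suc (2 * j) / 2   ≡⟨ cong (λ x → suc x / 2) (*-comm 2 j) ⟩
  (1 + j * 2) / 2   ≡⟨ +-distrib-/-∣ʳ 1 {d = 2} (divides-refl j) ⟩
  j * 2 / 2         ≡⟨ m*n/n≡m j 2 ⟩
  j                 ∎
  where open ≡-Reasoning

mainTheorem7 : (m k : ℕ) →
    (2 * k < suc m → NumberOfSequences m (λ s → MatchingNumber (thresholdGraph s) k) (suc m C k)) ×
    (2 * k ≡ suc m → NumberOfSequences m (λ s → MatchingNumber (thresholdGraph s) k) (m C (m / 2)))
mainTheorem7 m k =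
  (λ 2k<1+m → byMatchingNumber (proj₁ (levels m k) 2k<1+m)) ,
  (λ 2k≡1+m → subst (NumberOfSequences m _) (cong (m C_) (sym (m/2≡pred[k] k 2k≡1+m)))
                    (byMatchingNumber (proj₂ (levels m k) 2k≡1+m)))
  where
  byMatchingNumber : ∀ {c} → NumberOfSequences m (λ s → ν₀ s ≡ k) c →
    NumberOfSequences m (λ s → MatchingNumber (thresholdGraph s) k) c
  byMatchingNumber = numberOfSequences-⇔ (λ s → ν₀≡⇔matchingNumber s)
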